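{- Let $D=(E,\mathcal F)$ be a delta-matroid and $e\in E$. Then $e$ is not a ribbon loop (respectively, is an orientable ribbon loop, is a non-orientable ribbon loop) if and only if $D|_e=D\backslash(E\setminus\{e\})$ is isomorphic to $D_c=(\{e\},\{\{e\}\})$ (respectively, to $D_o=(\{e\},\{\emptyset\})$, to $D_n=(\{e\},\{\emptyset,\{e\}\})$).
   Context: A delta-matroid $D=(E,\mathcal F)$: finite $E$ and nonempty family $\mathcal F$ of subsets with: for $X,Y\in\mathcal F$ and $u\in X\triangle Y$ there is $v\in X\triangle Y$ with $X\triangle\{u,v\}\in\mathcal F$. $e$ is a coloop of $D$ if in every feasible set, a loop if in none. Deletion: if $e$ is not a coloop, $D\backslash e=(E\setminus e,\{F\in\mathcal F:e\notin F\})$; if $e$ is a coloop, $D\backslash e=(E\setminus e,\{F\setminus e:F\in\mathcal F\})$. Twist: $D*A=(E,\{A\triangle X:X\in\mathcal F\})$. $\mathcal F_{\min}$ is the set of feasible sets of minimum cardinality, and $D_{\min}=(E,\mathcal F_{\min})$ (a matroid given by its bases); an element is a loop of $D_{\min}$ if it lies in no set of $\mathcal F_{\min}$. $e$ is a ribbon loop of $D$ if it is a loop of $D_{\min}$; a ribbon loop is orientable if $e$ is not a loop of $(D*\{e\})_{\min}$ and non-orientable if it is. -}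

module Defs where

open import Data.Nat using (ℕ; _≤_)
open import Data.Bool using (Bool; true; false; if_then_else_; _xor_; not)
open import Data.Fin using (Fin)
open import Data.Fin.Subset using (Subset; ⁅_⁆; _∈_; _∉_; _⊆_; _∪_; ∣_∣; _-_)
open import Data.Vec using (lookup; tabulate; zipWith)
open import Data.List using (List; []; _∷_; map; allFin; foldl)
open import Data.Bool using (_∧_)
open import Data.List.Membership.Propositional using () renaming (_∈_ to _∈ₗ_)
open import Data.Product using (Σ; _×_; ∃-syntax)
open import Relation.Nullary using (¬_)
open import Relation.Binary.PropositionalEquality using (_≡_)
open import Function.Bundles using (Inverse; _↔_; _⇔_)

-- A set system over the universe Fin n: a ground set E ⊆ Fin n and a finite
-- family F of subsets (given as a list; list membership is the family membership).
record SetSystem (n : ℕ) : Set where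
  constructor setSystem
  field
    E : Subset n
    F : List (Subset n)
open SetSystem public

_⊕_ : ∀ {n} → Subset n → Subset n → Subset n
X ⊕ Y = zipWith _xor_ X Y

record IsDeltaMatroid {n : ℕ} (D : SetSystem n) : Set where
  field
    feasible⊆E : ∀ X → X ∈ₗ F D → X ⊆ E D
    nonempty   : ∃[ X ] (X ∈ₗ F D)
    exchange   : ∀ X Y → X ∈ₗ F D → Y ∈ₗ F D → ∀ u → u ∈ (X ⊕ Y) →
                 ∃[ v ] (v ∈ (X ⊕ Y) × (X ⊕ (⁅ u ⁆ ∪ ⁅ v ⁆)) ∈ₗ F D)

isColoopᵇ : ∀ {n} → SetSystem n → Fin n → Bool
isColoopᵇ D e = go (F D)
  where
  go : List _ → Bool
  go [] = true
  go (X ∷ Xs) = lookup X e ∧ go Xs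

avoiding : ∀ {n} → Fin n → List (Subset n) → List (Subset n)
avoiding e [] = []
avoiding e (X ∷ Xs) = if lookup X e then avoiding e Xs else X ∷ avoiding e Xs

delete : ∀ {n} → SetSystem n → Fin n → SetSystem n
delete D e =
  setSystem (E D - e)
    (if isColoopᵇ D e then map (λ X → X - e) (F D) else avoiding e (F D))

deleteSet : ∀ {n} → SetSystem n → Subset n → SetSystem n
deleteSet {n} D X = foldl (λ D' i → if lookup X i then delete D' i else D') D (allFin n)

restrict : ∀ {n} → SetSystem n → Fin n → SetSystem n
restrict D e = deleteSet D (E D - e)

twist : ∀ {n} → SetSystem n → Subset n → SetSystem n
twist D A = setSystem (E D) (map (λ X → A ⊕ X) (F D))

IsMinFeasible : ∀ {n} → SetSystem n → Subset n → Set
IsMinFeasible D X = X ∈ₗ F D × (∀ Y → Y ∈ₗ F D → ∣ X ∣ ≤ ∣ Y ∣)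

-- e is a ribbon loop: a loop of D_min (in no set of F_min)
RibbonLoop : ∀ {n} → SetSystem n → Fin n → Set
RibbonLoop D e = ∀ X → IsMinFeasible D X → e ∉ X

OrientableRibbonLoop : ∀ {n} → SetSystem n → Fin n → Set
OrientableRibbonLoop D e = RibbonLoop D e × ¬ RibbonLoop (twist D ⁅ e ⁆) e

NonOrientableRibbonLoop : ∀ {n} → SetSystem n → Fin n → Set
NonOrientableRibbonLoop D e = RibbonLoop D e × RibbonLoop (twist D ⁅ e ⁆) e

image : ∀ {n} → (Fin n ↔ Fin n) → Subset n → Subset n
image π X = tabulate (λ j → lookup X (Inverse.from π j))

_≅_ : ∀ {n} → SetSystem n → SetSystem n → Set
_≅_ {n} D D' = Σ (Fin n ↔ Fin n) λ π →
  (image π (E D) ≡ E D') × (∀ X → X ∈ₗ F D ⇔ image π X ∈ₗ F D')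

Dc Do Dn : ∀ {n} → Fin n → SetSystem n
Dc e = setSystem ⁅ e ⁆ (⁅ e ⁆ ∷ [])
Do e = setSystem ⁅ e ⁆ (Data.Fin.Subset.⊥ ∷ [])
Dn e = setSystem ⁅ e ⁆ (Data.Fin.Subset.⊥ ∷ ⁅ e ⁆ ∷ [])

-- Deleting an element i ≠ e preserves delta-matroids and does not change whether e is a
-- ribbon loop: if i is a coloop, removing it from every feasible set lowers all sizes by one;
-- otherwise the exchange axiom turns a minimum feasible set containing i into one of the same
-- size avoiding i, without touching its other elements. Deletion also commutes with twisting
-- by {e}. Hence e is a ribbon loop of D (of D * {e}) iff it is one of D|e (of D|e * {e}). The
-- feasible sets of D|e lie among ∅ and {e}, so e is a ribbon loop of D|e iff ∅ is feasible,
-- and of D|e * {e} iff {e} is feasible; these two facts tell D_c, D_o and D_n apart.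

module Submission where

open import Defs
open import Data.Bool using (true; false; not; _∧_; _∨_; _xor_; if_then_else_)
open import Data.Bool.Properties using (xor-assoc; xor-comm; xor-same; xor-identityʳ; xor-annihilates-not)
open import Data.Empty using (⊥-elim)
open import Data.Fin using (Fin; zero; suc; _≟_)
open import Data.Fin.Subset using (Subset; ⁅_⁆; _∈_; _⊆_; _∪_; _─_; _-_; ∣_∣) renaming (⊥ to ∅)
open import Data.Fin.Subset.Properties
  using (x∈⁅x⁆; x∈⁅y⁆⇒x≡y; ∣⊥∣≡0; ⊥⊆; ∪-identityˡ; ∪-identityʳ; ∪-idem; p─q⊆p; x∈p∧x≢y⇒x∈p-y)
open import Data.List using (List; []; _∷_; map; foldl; allFin)
open import Data.List.Extrema.Nat using (argmin; argmin-sel; f[argmin]≤f[⊤]; f[argmin]≤f[xs])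
open import Data.List.Membership.Propositional using () renaming (_∈_ to _∈ₗ_)
open import Data.List.Membership.Propositional.Properties using (∈-map⁺; ∈-map⁻; ∈-allFin)
open import Data.List.Properties using (map-∘; map-cong)
open import Data.List.Relation.Unary.All as All using ()
open import Data.List.Relation.Unary.Any using (here; there)
open import Data.Nat using (suc; _≤_; _<_; s≤s; s≤s⁻¹)
open import Data.Nat.Properties using (<⇒≱; n≤1+n; ≤-reflexive; ≤-trans)
open import Data.Product using (_×_; _,_; ∃-syntax; proj₁; proj₂)
open import Data.Product.Function.NonDependent.Propositional using (_×-⇔_)
open import Data.Sum using (_⊎_; inj₁; inj₂)
open import Data.Vec using ([]; _∷_; lookup)
open import Data.Vec.Properties
  using (lookup∘tabulate; lookup-zipWith; lookup-replicate; zipWith-assoc; zipWith-comm;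
         zipWith-identityˡ; zipWith-identityʳ; []=⇒lookup; lookup⇒[]=)
open import Function using (_∘_; case_of_)
open import Function.Bundles using (_⇔_; mk⇔; Equivalence; Inverse; _↔_)
open import Function.Properties.Equivalence using () renaming (refl to ⇔-refl; sym to ⇔-sym; trans to ⇔-trans)
open import Function.Properties.Inverse using (↔-refl)
open import Function.Related.TypeIsomorphisms using (¬-cong-⇔)
open import Relation.Binary.PropositionalEquality
open import Relation.Nullary using (¬_; yes; no)

-- Subsets as bit vectors

Subset-ext : ∀ {n} {X Y : Subset n} → (∀ j → lookup X j ≡ lookup Y j) → X ≡ Y
Subset-ext {X = []} {[]} _ = refl
Subset-ext {X = x ∷ X} {y ∷ Y} eq = cong₂ _∷_ (eq zero) (Subset-ext (eq ∘ suc))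

lookup-⊕ : ∀ {n} (X Y : Subset n) j → lookup (X ⊕ Y) j ≡ lookup X j xor lookup Y j
lookup-⊕ X Y j = lookup-zipWith _xor_ j X Y

lookup-⁅x⁆-self : ∀ {n} (x : Fin n) → lookup ⁅ x ⁆ x ≡ true
lookup-⁅x⁆-self zero = refl
lookup-⁅x⁆-self (suc x) = lookup-⁅x⁆-self x

lookup-⁅x⁆-other : ∀ {n} {x j : Fin n} → j ≢ x → lookup ⁅ x ⁆ j ≡ false
lookup-⁅x⁆-other {x = zero} {zero} j≢x = ⊥-elim (j≢x refl)
lookup-⁅x⁆-other {x = zero} {suc j} _ = lookup-replicate j false
lookup-⁅x⁆-other {x = suc x} {zero} _ = refl
lookup-⁅x⁆-other {x = suc x} {suc j} j≢x = lookup-⁅x⁆-other (j≢x ∘ cong suc)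

lookup-─ : ∀ {n} (S X : Subset n) j → lookup (S ─ X) j ≡ (if lookup X j then false else lookup S j)
lookup-─ (s ∷ S) (true ∷ X) zero = refl
lookup-─ (s ∷ S) (false ∷ X) zero = refl
lookup-─ (s ∷ S) (x ∷ X) (suc j) = lookup-─ S X j

lookup-minus-self : ∀ {n} (S : Subset n) x → lookup (S - x) x ≡ false
lookup-minus-self S x rewrite lookup-─ S ⁅ x ⁆ x | lookup-⁅x⁆-self x = refl

lookup-minus-other : ∀ {n} (S : Subset n) {x j} → j ≢ x → lookup (S - x) j ≡ lookup S j
lookup-minus-other S {x} {j} j≢x rewrite lookup-─ S ⁅ x ⁆ j | lookup-⁅x⁆-other j≢x = refl

lookup-minus-false : ∀ {n} (S : Subset n) {i j} → lookup S j ≡ false → lookup (S - i) j ≡ false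
lookup-minus-false S {i} {j} Sj rewrite lookup-─ S ⁅ i ⁆ j | Sj with lookup ⁅ i ⁆ j
... | true = refl
... | false = refl

⊕-assoc : ∀ {n} (X Y Z : Subset n) → (X ⊕ Y) ⊕ Z ≡ X ⊕ (Y ⊕ Z)
⊕-assoc = zipWith-assoc xor-assoc

⊕-comm : ∀ {n} (X Y : Subset n) → X ⊕ Y ≡ Y ⊕ X
⊕-comm = zipWith-comm xor-comm

⊕-identityˡ : ∀ {n} (X : Subset n) → ∅ ⊕ X ≡ X
⊕-identityˡ = zipWith-identityˡ (λ _ → refl)

⊕-identityʳ : ∀ {n} (X : Subset n) → X ⊕ ∅ ≡ X
⊕-identityʳ = zipWith-identityʳ xor-identityʳ

⊕-involutive : ∀ {n} (A X : Subset n) → A ⊕ (A ⊕ X) ≡ X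
⊕-involutive [] [] = refl
⊕-involutive (a ∷ A) (x ∷ X) =
  cong₂ _∷_ (trans (sym (xor-assoc a a x)) (cong (_xor x) (xor-same a))) (⊕-involutive A X)

⊕-self : ∀ {n} (A : Subset n) → A ⊕ A ≡ ∅
⊕-self A = trans (cong (A ⊕_) (sym (⊕-identityʳ A))) (⊕-involutive A ∅)

⊕-cancelˡ : ∀ {n} (A X Y : Subset n) → (A ⊕ X) ⊕ (A ⊕ Y) ≡ X ⊕ Y
⊕-cancelˡ [] [] [] = refl
⊕-cancelˡ (true ∷ A) (x ∷ X) (y ∷ Y) = cong₂ _∷_ (xor-annihilates-not x y) (⊕-cancelˡ A X Y)
⊕-cancelˡ (false ∷ A) (x ∷ X) (y ∷ Y) = cong ((x xor y) ∷_) (⊕-cancelˡ A X Y)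

⁅⁆∪⁅⁆≡⁅⁆⊕⁅⁆ : ∀ {n} {x y : Fin n} → x ≢ y → ⁅ x ⁆ ∪ ⁅ y ⁆ ≡ ⁅ x ⁆ ⊕ ⁅ y ⁆
⁅⁆∪⁅⁆≡⁅⁆⊕⁅⁆ {x = zero} {zero} x≢y = ⊥-elim (x≢y refl)
⁅⁆∪⁅⁆≡⁅⁆⊕⁅⁆ {x = zero} {suc y} _ = cong (true ∷_) (trans (∪-identityˡ _) (sym (⊕-identityˡ _)))
⁅⁆∪⁅⁆≡⁅⁆⊕⁅⁆ {x = suc x} {zero} _ = cong (true ∷_) (trans (∪-identityʳ _) (sym (⊕-identityʳ _)))
⁅⁆∪⁅⁆≡⁅⁆⊕⁅⁆ {x = suc x} {suc y} x≢y = cong (false ∷_) (⁅⁆∪⁅⁆≡⁅⁆⊕⁅⁆ (x≢y ∘ cong suc))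

flip-pair : ∀ {n} (X : Subset n) {i v} → i ≢ v → X ⊕ (⁅ i ⁆ ∪ ⁅ v ⁆) ≡ (X ⊕ ⁅ i ⁆) ⊕ ⁅ v ⁆
flip-pair X i≢v = trans (cong (X ⊕_) (⁅⁆∪⁅⁆≡⁅⁆⊕⁅⁆ i≢v)) (sym (⊕-assoc X _ _))

lookup-flip-self : ∀ {n} (X : Subset n) u → lookup (X ⊕ ⁅ u ⁆) u ≡ not (lookup X u)
lookup-flip-self X u rewrite lookup-⊕ X ⁅ u ⁆ u | lookup-⁅x⁆-self u = xor-true (lookup X u)
  where
  xor-true : ∀ b → b xor true ≡ not b
  xor-true true = refl
  xor-true false = refl

lookup-flip-other : ∀ {n} (X : Subset n) {u j} → j ≢ u → lookup (X ⊕ ⁅ u ⁆) j ≡ lookup X j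
lookup-flip-other X {u} {j} j≢u rewrite lookup-⊕ X ⁅ u ⁆ j | lookup-⁅x⁆-other j≢u = xor-identityʳ (lookup X j)

lookup-⊕-outside : ∀ {n} (A X : Subset n) {i} → lookup A i ≡ false → lookup (A ⊕ X) i ≡ lookup X i
lookup-⊕-outside A X {i} Ai rewrite lookup-⊕ A X i | Ai = refl

lookup-⊕-agree : ∀ {n} (X Y : Subset n) {i} → lookup X i ≡ lookup Y i → lookup (X ⊕ Y) i ≡ false
lookup-⊕-agree X Y {i} Xi≡Yi rewrite lookup-⊕ X Y i | Xi≡Yi = xor-same (lookup Y i)

lookup-⁅⁆∪⁅⁆-other : ∀ {n} {u v i : Fin n} → u ≢ i → v ≢ i → lookup (⁅ u ⁆ ∪ ⁅ v ⁆) i ≡ false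
lookup-⁅⁆∪⁅⁆-other {u = u} {v} {i} u≢i v≢i
  rewrite lookup-zipWith _∨_ i ⁅ u ⁆ ⁅ v ⁆ | lookup-⁅x⁆-other (u≢i ∘ sym) | lookup-⁅x⁆-other (v≢i ∘ sym) = refl

∈-⊕⁺ : ∀ {n} (X Z : Subset n) {j} → lookup X j ≡ true → lookup Z j ≡ false → j ∈ X ⊕ Z
∈-⊕⁺ X Z {j} Xj Zj = lookup⇒[]= j (X ⊕ Z) (trans (lookup-⊕ X Z j) (cong₂ _xor_ Xj Zj))

∈-⊕⁻ : ∀ {n} (X Y : Subset n) {j} → j ∈ X ⊕ Y → j ∈ X ⊎ j ∈ Y
∈-⊕⁻ X Y {j} j∈ with lookup X j in Xj | lookup Y j in Yj
... | true | _ = inj₁ (lookup⇒[]= j X Xj)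
... | false | true = inj₂ (lookup⇒[]= j Y Yj)
... | false | false = case trans (sym ([]=⇒lookup j∈)) (trans (lookup-⊕ X Y j) (cong₂ _xor_ Xj Yj)) of λ ()

∈∧lookup-false⇒≢ : ∀ {n} {X : Subset n} {i j} → lookup X i ≡ false → j ∈ X → j ≢ i
∈∧lookup-false⇒≢ Xi j∈X refl = case trans (sym Xi) ([]=⇒lookup j∈X) of λ ()

lookup-⁅⁆∪⁅⁆-agree : ∀ {n} (X Y : Subset n) {i u v} → lookup X i ≡ lookup Y i →
  u ∈ X ⊕ Y → v ∈ X ⊕ Y → lookup (⁅ u ⁆ ∪ ⁅ v ⁆) i ≡ false
lookup-⁅⁆∪⁅⁆-agree X Y {i} Xi≡Yi u∈ v∈ =
  lookup-⁅⁆∪⁅⁆-other (∈∧lookup-false⇒≢ X⊕Y-avoids-i u∈) (∈∧lookup-false⇒≢ X⊕Y-avoids-i v∈)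
  where
  X⊕Y-avoids-i : lookup (X ⊕ Y) i ≡ false
  X⊕Y-avoids-i = lookup-⊕-agree X Y Xi≡Yi

minus≡flip : ∀ {n} (X : Subset n) u → lookup X u ≡ true → X - u ≡ X ⊕ ⁅ u ⁆
minus≡flip X u Xu = Subset-ext pointwise
  where
  pointwise : ∀ j → lookup (X - u) j ≡ lookup (X ⊕ ⁅ u ⁆) j
  pointwise j with j ≟ u
  ... | yes refl rewrite lookup-minus-self X j | lookup-flip-self X j | Xu = refl
  ... | no j≢u rewrite lookup-minus-other X j≢u | lookup-flip-other X j≢u = refl

minus-⊕-minus : ∀ {n} (X Y : Subset n) {i} → lookup X i ≡ true → lookup Y i ≡ true → (X - i) ⊕ (Y - i) ≡ X ⊕ Y
minus-⊕-minus X Y {i} Xi Yi = Subset-ext pointwise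
  where
  pointwise : ∀ j → lookup ((X - i) ⊕ (Y - i)) j ≡ lookup (X ⊕ Y) j
  pointwise j rewrite lookup-⊕ (X - i) (Y - i) j | lookup-⊕ X Y j with j ≟ i
  ... | yes refl rewrite lookup-minus-self X j | lookup-minus-self Y j | Xi | Yi = refl
  ... | no j≢i rewrite lookup-minus-other X j≢i | lookup-minus-other Y j≢i = refl

minus-⊕ : ∀ {n} (X S : Subset n) {i} → lookup S i ≡ false → (X - i) ⊕ S ≡ (X ⊕ S) - i
minus-⊕ X S {i} Si = Subset-ext pointwise
  where
  pointwise : ∀ j → lookup ((X - i) ⊕ S) j ≡ lookup ((X ⊕ S) - i) j
  pointwise j rewrite lookup-⊕ (X - i) S j with j ≟ i
  ... | yes refl rewrite lookup-minus-self X j | lookup-minus-self (X ⊕ S) j | Si = refl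
  ... | no j≢i rewrite lookup-minus-other X j≢i | lookup-minus-other (X ⊕ S) j≢i | lookup-⊕ X S j = refl

minus-twist : ∀ {n} (A X : Subset n) {i} → lookup A i ≡ false → (A ⊕ X) - i ≡ A ⊕ (X - i)
minus-twist A X {i} Ai = begin
  (A ⊕ X) - i  ≡⟨ cong (_- i) (⊕-comm A X) ⟩
  (X ⊕ A) - i  ≡⟨ minus-⊕ X A Ai ⟨
  (X - i) ⊕ A  ≡⟨ ⊕-comm (X - i) A ⟩
  A ⊕ (X - i)  ∎
  where open ≡-Reasoning

⊆-minus : ∀ {n} {X S : Subset n} {i} → X ⊆ S → lookup X i ≡ false → X ⊆ S - i
⊆-minus X⊆S Xi j∈X = x∈p∧x≢y⇒x∈p-y (X⊆S j∈X) (∈∧lookup-false⇒≢ Xi j∈X)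

∅≢⁅x⁆ : ∀ {n} {x : Fin n} → ∅ ≢ ⁅ x ⁆
∅≢⁅x⁆ {x = x} ∅≡⁅x⁆ =
  case trans (sym (lookup-replicate x false)) (trans (cong (λ S → lookup S x) ∅≡⁅x⁆) (lookup-⁅x⁆-self x)) of λ ()

⊆⁅x⁆ : ∀ {n} {X : Subset n} {x} → X ⊆ ⁅ x ⁆ → X ≡ ∅ ⊎ X ≡ ⁅ x ⁆
⊆⁅x⁆ {X = X} {x} X⊆ with lookup X x in Xx
... | false = inj₁ (Subset-ext λ j → trans (outside-x j) (sym (lookup-replicate j false)))
  where
  outside-x : ∀ j → lookup X j ≡ false
  outside-x j with lookup X j in Xj
  ... | false = refl
  ... | true with x∈⁅y⁆⇒x≡y x (X⊆ (lookup⇒[]= j X Xj))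
  ...   | refl = trans (sym Xj) Xx
... | true = inj₂ (Subset-ext pointwise)
  where
  pointwise : ∀ j → lookup X j ≡ lookup ⁅ x ⁆ j
  pointwise j with j ≟ x
  ... | yes refl = trans Xx (sym (lookup-⁅x⁆-self j))
  ... | no j≢x with lookup X j in Xj
  ...   | false = sym (lookup-⁅x⁆-other j≢x)
  ...   | true = ⊥-elim (j≢x (x∈⁅y⁆⇒x≡y x (X⊆ (lookup⇒[]= j X Xj))))

∣flip-in∣ : ∀ {n} (X : Subset n) u → lookup X u ≡ true → ∣ X ∣ ≡ suc ∣ X ⊕ ⁅ u ⁆ ∣
∣flip-in∣ (true ∷ X) zero _ = cong (suc ∘ ∣_∣) (sym (⊕-identityʳ X))
∣flip-in∣ (true ∷ X) (suc u) Xu = cong suc (∣flip-in∣ X u Xu)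
∣flip-in∣ (false ∷ X) (suc u) Xu = ∣flip-in∣ X u Xu

∣flip-out∣ : ∀ {n} (X : Subset n) u → lookup X u ≡ false → ∣ X ⊕ ⁅ u ⁆ ∣ ≡ suc ∣ X ∣
∣flip-out∣ (false ∷ X) zero _ = cong (suc ∘ ∣_∣) (⊕-identityʳ X)
∣flip-out∣ (true ∷ X) (suc u) Xu = cong suc (∣flip-out∣ X u Xu)
∣flip-out∣ (false ∷ X) (suc u) Xu = ∣flip-out∣ X u Xu

∣minus∣ : ∀ {n} (X : Subset n) u → lookup X u ≡ true → ∣ X ∣ ≡ suc ∣ X - u ∣
∣minus∣ X u Xu = trans (∣flip-in∣ X u Xu) (cong (suc ∘ ∣_∣) (sym (minus≡flip X u Xu)))

-- Minimum feasible sets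

minFeasible-exists : ∀ {n} (D : SetSystem n) → ∃[ X ] (X ∈ₗ F D) → ∃[ M ] IsMinFeasible D M
minFeasible-exists (setSystem _ (Y ∷ Ys)) _ = M , M∈ , M-minimal
  where
  M : Subset _
  M = argmin ∣_∣ Y Ys
  M∈ : M ∈ₗ Y ∷ Ys
  M∈ with argmin-sel ∣_∣ Y Ys
  ... | inj₁ M≡Y = here M≡Y
  ... | inj₂ M∈Ys = there M∈Ys
  M-minimal : ∀ Z → Z ∈ₗ Y ∷ Ys → ∣ M ∣ ≤ ∣ Z ∣
  M-minimal Z (here refl) = f[argmin]≤f[⊤] {f = ∣_∣} Y Ys
  M-minimal Z (there Z∈Ys) = All.lookup (f[argmin]≤f[xs] {f = ∣_∣} Y Ys) Z∈Ys

minFeasible-no-smaller : ∀ {n} {D : SetSystem n} {X Y} → IsMinFeasible D X → Y ∈ₗ F D → ¬ ∣ Y ∣ < ∣ X ∣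
minFeasible-no-smaller (_ , X-minimal) Y∈ Y<X = <⇒≱ Y<X (X-minimal _ Y∈)

-- Minimality rules out the partner v = i, and also any v ∈ X, as both shrink X.
minFeasible-exchange : ∀ {n} {D : SetSystem n} {X Z i} → IsDeltaMatroid D → IsMinFeasible D X →
  lookup X i ≡ true → Z ∈ₗ F D → lookup Z i ≡ false →
  ∃[ v ] (v ≢ i × lookup X v ≡ false × (X ⊕ ⁅ i ⁆) ⊕ ⁅ v ⁆ ∈ₗ F D)
minFeasible-exchange {D = D} {X} {Z} {i} isDM X-min@(X∈ , _) Xi Z∈ Zi
  with IsDeltaMatroid.exchange isDM X Z X∈ Z∈ i (∈-⊕⁺ X Z Xi Zi)
... | v , _ , X⊕iv∈ with v ≟ i
...   | yes refl = ⊥-elim (minFeasible-no-smaller {D = D} X-min X⊕i∈ (≤-reflexive (sym (∣flip-in∣ X v Xi))))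
  where
  X⊕i∈ : X ⊕ ⁅ v ⁆ ∈ₗ F D
  X⊕i∈ = subst (_∈ₗ F D) (cong (X ⊕_) (∪-idem ⁅ v ⁆)) X⊕iv∈
...   | no v≢i with lookup X v in Xv
...     | false = v , v≢i , Xv , subst (_∈ₗ F D) (flip-pair X (v≢i ∘ sym)) X⊕iv∈
...     | true =
  ⊥-elim (minFeasible-no-smaller {D = D} X-min W∈ (subst (suc ∣ W ∣ ≤_) (sym ∣X∣≡2+∣W∣) (n≤1+n _)))
  where
  W : Subset _
  W = (X ⊕ ⁅ i ⁆) ⊕ ⁅ v ⁆
  W∈ : W ∈ₗ F D
  W∈ = subst (_∈ₗ F D) (flip-pair X (v≢i ∘ sym)) X⊕iv∈
  ∣X∣≡2+∣W∣ : ∣ X ∣ ≡ suc (suc ∣ W ∣)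
  ∣X∣≡2+∣W∣ = trans (∣flip-in∣ X i Xi)
    (cong suc (∣flip-in∣ (X ⊕ ⁅ i ⁆) v (trans (lookup-flip-other X v≢i) Xv)))

minFeasible-avoiding : ∀ {n} {D : SetSystem n} {i} → IsDeltaMatroid D →
  ∃[ Z ] (Z ∈ₗ F D × lookup Z i ≡ false) → ∀ {X} → IsMinFeasible D X →
  ∃[ W ] (IsMinFeasible D W × lookup W i ≡ false × (∀ {j} → j ≢ i → lookup X j ≡ true → lookup W j ≡ true))
minFeasible-avoiding {D = D} {i} isDM (Z , Z∈ , Zi) {X} X-min@(_ , X-minimal) with lookup X i in Xi
... | false = X , X-min , Xi , λ _ Xj → Xj
... | true with minFeasible-exchange isDM X-min Xi Z∈ Zi
...   | v , v≢i , Xv , W∈ = W , (W∈ , W-minimal) , Wi , keeps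
  where
  W : Subset _
  W = (X ⊕ ⁅ i ⁆) ⊕ ⁅ v ⁆
  ∣W∣≡∣X∣ : ∣ W ∣ ≡ ∣ X ∣
  ∣W∣≡∣X∣ = trans (∣flip-out∣ (X ⊕ ⁅ i ⁆) v (trans (lookup-flip-other X v≢i) Xv)) (sym (∣flip-in∣ X i Xi))
  W-minimal : ∀ Y → Y ∈ₗ F D → ∣ W ∣ ≤ ∣ Y ∣
  W-minimal Y Y∈ = subst (_≤ ∣ Y ∣) (sym ∣W∣≡∣X∣) (X-minimal Y Y∈)
  Wi : lookup W i ≡ false
  Wi = trans (lookup-flip-other (X ⊕ ⁅ i ⁆) (v≢i ∘ sym)) (trans (lookup-flip-self X i) (cong not Xi))
  keeps : ∀ {j} → j ≢ i → lookup X j ≡ true → lookup W j ≡ true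
  keeps {j} j≢i Xj = trans (lookup-flip-other (X ⊕ ⁅ i ⁆) j≢v) (trans (lookup-flip-other X j≢i) Xj)
    where
    j≢v : j ≢ v
    j≢v refl = case trans (sym Xj) Xv of λ ()

-- Deleting an element

∈-avoiding⁺ : ∀ {n} {i : Fin n} {X Xs} → X ∈ₗ Xs → lookup X i ≡ false → X ∈ₗ avoiding i Xs
∈-avoiding⁺ {Xs = Y ∷ Ys} (here refl) Xi rewrite Xi = here refl
∈-avoiding⁺ {i = i} {Xs = Y ∷ Ys} (there X∈) Xi with lookup Y i
... | true = ∈-avoiding⁺ X∈ Xi
... | false = there (∈-avoiding⁺ X∈ Xi)

∈-avoiding⁻ : ∀ {n} {i : Fin n} {X Xs} → X ∈ₗ avoiding i Xs → X ∈ₗ Xs × lookup X i ≡ false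
∈-avoiding⁻ {i = i} {Xs = Y ∷ Ys} X∈ with lookup Y i in Yi
∈-avoiding⁻ {Xs = Y ∷ Ys} X∈ | true = let (X∈Ys , Xi) = ∈-avoiding⁻ X∈ in there X∈Ys , Xi
∈-avoiding⁻ {Xs = Y ∷ Ys} (here refl) | false = here refl , Yi
∈-avoiding⁻ {Xs = Y ∷ Ys} (there X∈) | false = let (X∈Ys , Xi) = ∈-avoiding⁻ X∈ in there X∈Ys , Xi

isColoopᵇ⇒∈all : ∀ {n} E (Xs : List (Subset n)) {i} → isColoopᵇ (setSystem E Xs) i ≡ true →
  ∀ X → X ∈ₗ Xs → lookup X i ≡ true
isColoopᵇ⇒∈all E (Y ∷ Ys) {i} coloop X X∈ with lookup Y i in Yi
isColoopᵇ⇒∈all E (Y ∷ Ys) coloop X (here refl) | true = Yi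
isColoopᵇ⇒∈all E (Y ∷ Ys) coloop X (there X∈) | true = isColoopᵇ⇒∈all E Ys coloop X X∈

¬isColoopᵇ⇒avoided : ∀ {n} E (Xs : List (Subset n)) {i} → isColoopᵇ (setSystem E Xs) i ≡ false →
  ∃[ Z ] (Z ∈ₗ Xs × lookup Z i ≡ false)
¬isColoopᵇ⇒avoided E (Y ∷ Ys) {i} notColoop with lookup Y i in Yi
... | false = Y , here refl , Yi
... | true with ¬isColoopᵇ⇒avoided E Ys notColoop
...   | Z , Z∈ , Zi = Z , there Z∈ , Zi

module _ {n} {D : SetSystem n} {i : Fin n} (E′ : Subset n) where

  private
    D∖i : SetSystem n
    D∖i = setSystem E′ (avoiding i (F D))

  minFeasible-avoiding⁺ : ∀ {W} → IsMinFeasible D W → lookup W i ≡ false → IsMinFeasible D∖i W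
  minFeasible-avoiding⁺ (W∈ , W-minimal) Wi =
    ∈-avoiding⁺ W∈ Wi , λ Y Y∈ → W-minimal Y (proj₁ (∈-avoiding⁻ Y∈))

  minFeasible-avoiding⁻ : IsDeltaMatroid D → ∃[ Z ] (Z ∈ₗ F D × lookup Z i ≡ false) →
    ∀ {X} → IsMinFeasible D∖i X → IsMinFeasible D X
  minFeasible-avoiding⁻ isDM avoided {X} (X∈ , X-minimal)
    with minFeasible-avoiding isDM avoided (proj₂ (minFeasible-exists D (IsDeltaMatroid.nonempty isDM)))
  ... | W , W-min@(_ , W-minimal) , Wi , _ = proj₁ (∈-avoiding⁻ X∈) , X-minimal′
    where
    X-minimal′ : ∀ Y → Y ∈ₗ F D → ∣ X ∣ ≤ ∣ Y ∣
    X-minimal′ Y Y∈ = ≤-trans (X-minimal W (proj₁ (minFeasible-avoiding⁺ W-min Wi))) (W-minimal Y Y∈)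

  ribbonLoop-avoiding : IsDeltaMatroid D → ∃[ Z ] (Z ∈ₗ F D × lookup Z i ≡ false) →
    ∀ {e} → i ≢ e → RibbonLoop D∖i e ⇔ RibbonLoop D e
  ribbonLoop-avoiding isDM avoided {e} i≢e = mk⇔ to from
    where
    to : RibbonLoop D∖i e → RibbonLoop D e
    to loop X X-min e∈X with minFeasible-avoiding isDM avoided X-min
    ... | W , W-min , Wi , keeps =
      loop W (minFeasible-avoiding⁺ W-min Wi) (lookup⇒[]= e W (keeps (i≢e ∘ sym) ([]=⇒lookup e∈X)))
    from : RibbonLoop D e → RibbonLoop D∖i e
    from loop X X-min = loop X (minFeasible-avoiding⁻ isDM avoided X-min)

module _ {n} {D : SetSystem n} {i : Fin n} (E′ : Subset n) (coloop : ∀ X → X ∈ₗ F D → lookup X i ≡ true) where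

  private
    D/i : SetSystem n
    D/i = setSystem E′ (map (λ X → X - i) (F D))

  ∣minus∣-mono : ∀ {X Y} → X ∈ₗ F D → Y ∈ₗ F D → ∣ X ∣ ≤ ∣ Y ∣ ⇔ ∣ X - i ∣ ≤ ∣ Y - i ∣
  ∣minus∣-mono {X} {Y} X∈ Y∈ rewrite ∣minus∣ X i (coloop X X∈) | ∣minus∣ Y i (coloop Y Y∈) = mk⇔ s≤s⁻¹ s≤s

  minFeasible-removeColoop⁺ : ∀ {X} → IsMinFeasible D X → IsMinFeasible D/i (X - i)
  minFeasible-removeColoop⁺ {X} (X∈ , X-minimal) = ∈-map⁺ (λ X → X - i) X∈ , X-minimal′
    where
    X-minimal′ : ∀ Y′ → Y′ ∈ₗ F D/i → ∣ X - i ∣ ≤ ∣ Y′ ∣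
    X-minimal′ Y′ Y′∈ with ∈-map⁻ (λ X → X - i) Y′∈
    ... | Y , Y∈ , refl = Equivalence.to (∣minus∣-mono X∈ Y∈) (X-minimal Y Y∈)

  minFeasible-removeColoop⁻ : ∀ {X} → X ∈ₗ F D → IsMinFeasible D/i (X - i) → IsMinFeasible D X
  minFeasible-removeColoop⁻ X∈ (_ , X-minimal) =
    X∈ , λ Y Y∈ → Equivalence.from (∣minus∣-mono X∈ Y∈) (X-minimal (Y - i) (∈-map⁺ (λ X → X - i) Y∈))

  ribbonLoop-removeColoop : ∀ {e} → i ≢ e → RibbonLoop D/i e ⇔ RibbonLoop D e
  ribbonLoop-removeColoop {e} i≢e = mk⇔ to from
    where
    e∈X⇔e∈X-i : ∀ X → lookup (X - i) e ≡ lookup X e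
    e∈X⇔e∈X-i X = lookup-minus-other X (i≢e ∘ sym)
    to : RibbonLoop D/i e → RibbonLoop D e
    to loop X X-min e∈X =
      loop (X - i) (minFeasible-removeColoop⁺ X-min)
        (lookup⇒[]= e (X - i) (trans (e∈X⇔e∈X-i X) ([]=⇒lookup e∈X)))
    from : RibbonLoop D e → RibbonLoop D/i e
    from loop X′ X′-min@(X′∈ , _) e∈X′ with ∈-map⁻ (λ X → X - i) X′∈
    ... | X , X∈ , refl =
      loop X (minFeasible-removeColoop⁻ X∈ X′-min)
        (lookup⇒[]= e X (trans (sym (e∈X⇔e∈X-i X)) ([]=⇒lookup e∈X′)))

ribbonLoop-delete : ∀ {n} {D : SetSystem n} {i e} → IsDeltaMatroid D → i ≢ e →
  RibbonLoop (delete D i) e ⇔ RibbonLoop D e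
ribbonLoop-delete {D = D} {i} isDM i≢e with isColoopᵇ D i in coloop
... | true = ribbonLoop-removeColoop {D = D} (E D - i) (isColoopᵇ⇒∈all (E D) (F D) coloop) i≢e
... | false = ribbonLoop-avoiding (E D - i) isDM (¬isColoopᵇ⇒avoided (E D) (F D) coloop) i≢e

module _ {n} {D : SetSystem n} {i : Fin n} (isDM : IsDeltaMatroid D) where

  open IsDeltaMatroid isDM

  IsDeltaMatroid-removeColoop : (∀ X → X ∈ₗ F D → lookup X i ≡ true) →
    IsDeltaMatroid (setSystem (E D - i) (map (λ X → X - i) (F D)))
  IsDeltaMatroid-removeColoop coloop = record
    { feasible⊆E = feasible⊆E′
    ; nonempty = let (X , X∈) = nonempty in X - i , ∈-map⁺ (λ X → X - i) X∈
    ; exchange = exchange′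
    }
    where
    feasible⊆E′ : ∀ X′ → X′ ∈ₗ map (λ X → X - i) (F D) → X′ ⊆ E D - i
    feasible⊆E′ X′ X′∈ with ∈-map⁻ (λ X → X - i) X′∈
    ... | X , X∈ , refl = ⊆-minus (feasible⊆E X X∈ ∘ p─q⊆p X ⁅ i ⁆) (lookup-minus-self X i)
    exchange′ : ∀ X′ Y′ → X′ ∈ₗ map (λ X → X - i) (F D) → Y′ ∈ₗ map (λ X → X - i) (F D) →
      ∀ u → u ∈ X′ ⊕ Y′ → ∃[ v ] (v ∈ X′ ⊕ Y′ × X′ ⊕ (⁅ u ⁆ ∪ ⁅ v ⁆) ∈ₗ map (λ X → X - i) (F D))
    exchange′ X′ Y′ X′∈ Y′∈ u u∈ with ∈-map⁻ (λ X → X - i) X′∈ | ∈-map⁻ (λ X → X - i) Y′∈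
    ... | X , X∈ , refl | Y , Y∈ , refl
      rewrite minus-⊕-minus X Y (coloop X X∈) (coloop Y Y∈)
      with exchange X Y X∈ Y∈ u u∈
    ... | v , v∈ , X⊕S∈ = v , v∈ , subst (_∈ₗ _) (sym (minus-⊕ X _ S-avoids-i)) (∈-map⁺ (λ X → X - i) X⊕S∈)
      where
      S-avoids-i : lookup (⁅ u ⁆ ∪ ⁅ v ⁆) i ≡ false
      S-avoids-i = lookup-⁅⁆∪⁅⁆-agree X Y (trans (coloop X X∈) (sym (coloop Y Y∈))) u∈ v∈

  IsDeltaMatroid-avoiding : ∃[ Z ] (Z ∈ₗ F D × lookup Z i ≡ false) →
    IsDeltaMatroid (setSystem (E D - i) (avoiding i (F D)))
  IsDeltaMatroid-avoiding (Z , Z∈ , Zi) = record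
    { feasible⊆E = λ X X∈ → let (X∈D , Xi) = ∈-avoiding⁻ X∈ in ⊆-minus (feasible⊆E X X∈D) Xi
    ; nonempty = Z , ∈-avoiding⁺ Z∈ Zi
    ; exchange = exchange′
    }
    where
    exchange′ : ∀ X Y → X ∈ₗ avoiding i (F D) → Y ∈ₗ avoiding i (F D) →
      ∀ u → u ∈ X ⊕ Y → ∃[ v ] (v ∈ X ⊕ Y × X ⊕ (⁅ u ⁆ ∪ ⁅ v ⁆) ∈ₗ avoiding i (F D))
    exchange′ X Y X∈ Y∈ u u∈ with ∈-avoiding⁻ X∈ | ∈-avoiding⁻ Y∈
    ... | X∈D , Xi | Y∈D , Yi with exchange X Y X∈D Y∈D u u∈
    ... | v , v∈ , X⊕S∈ = v , v∈ , ∈-avoiding⁺ X⊕S∈ (lookup-⊕-agree X _ (trans Xi (sym S-avoids-i)))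
      where
      S-avoids-i : lookup (⁅ u ⁆ ∪ ⁅ v ⁆) i ≡ false
      S-avoids-i = lookup-⁅⁆∪⁅⁆-agree X Y (trans Xi (sym Yi)) u∈ v∈

IsDeltaMatroid-delete : ∀ {n} {D : SetSystem n} {i} → IsDeltaMatroid D → IsDeltaMatroid (delete D i)
IsDeltaMatroid-delete {D = D} {i} isDM with isColoopᵇ D i in coloop
... | true = IsDeltaMatroid-removeColoop isDM (isColoopᵇ⇒∈all (E D) (F D) coloop)
... | false = IsDeltaMatroid-avoiding isDM (¬isColoopᵇ⇒avoided (E D) (F D) coloop)

-- Twisting

IsDeltaMatroid-twist : ∀ {n} {D : SetSystem n} {A} → A ⊆ E D → IsDeltaMatroid D → IsDeltaMatroid (twist D A)
IsDeltaMatroid-twist {D = D} {A} A⊆E isDM = record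
  { feasible⊆E = feasible⊆E′
  ; nonempty = let (X , X∈) = nonempty in A ⊕ X , ∈-map⁺ (A ⊕_) X∈
  ; exchange = exchange′
  }
  where
  open IsDeltaMatroid isDM
  feasible⊆E′ : ∀ X′ → X′ ∈ₗ map (A ⊕_) (F D) → X′ ⊆ E D
  feasible⊆E′ X′ X′∈ j∈ with ∈-map⁻ (A ⊕_) X′∈
  ... | X , X∈ , refl with ∈-⊕⁻ A X j∈
  ...   | inj₁ j∈A = A⊆E j∈A
  ...   | inj₂ j∈X = feasible⊆E X X∈ j∈X
  exchange′ : ∀ X′ Y′ → X′ ∈ₗ map (A ⊕_) (F D) → Y′ ∈ₗ map (A ⊕_) (F D) →
    ∀ u → u ∈ X′ ⊕ Y′ → ∃[ v ] (v ∈ X′ ⊕ Y′ × X′ ⊕ (⁅ u ⁆ ∪ ⁅ v ⁆) ∈ₗ map (A ⊕_) (F D))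
  exchange′ X′ Y′ X′∈ Y′∈ u u∈ with ∈-map⁻ (A ⊕_) X′∈ | ∈-map⁻ (A ⊕_) Y′∈
  ... | X , X∈ , refl | Y , Y∈ , refl rewrite ⊕-cancelˡ A X Y with exchange X Y X∈ Y∈ u u∈
  ... | v , v∈ , X⊕S∈ = v , v∈ , subst (_∈ₗ _) (sym (⊕-assoc A X _)) (∈-map⁺ (A ⊕_) X⊕S∈)

isColoopᵇ-twist : ∀ {n} E (Xs : List (Subset n)) {A i} → lookup A i ≡ false →
  isColoopᵇ (twist (setSystem E Xs) A) i ≡ isColoopᵇ (setSystem E Xs) i
isColoopᵇ-twist E [] Ai = refl
isColoopᵇ-twist E (Y ∷ Ys) {A} Ai =
  cong₂ _∧_ (lookup-⊕-outside A Y Ai) (isColoopᵇ-twist E Ys Ai)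

avoiding-twist : ∀ {n} (Xs : List (Subset n)) {A i} → lookup A i ≡ false →
  avoiding i (map (A ⊕_) Xs) ≡ map (A ⊕_) (avoiding i Xs)
avoiding-twist [] Ai = refl
avoiding-twist (Y ∷ Ys) {A} {i} Ai rewrite lookup-⊕-outside A Y Ai with lookup Y i
... | true = avoiding-twist Ys Ai
... | false = cong ((A ⊕ Y) ∷_) (avoiding-twist Ys Ai)

delete-twist : ∀ {n} (D : SetSystem n) {A i} → lookup A i ≡ false → delete (twist D A) i ≡ twist (delete D i) A
delete-twist D {A} {i} Ai
  with isColoopᵇ (twist D A) i | isColoopᵇ D i | isColoopᵇ-twist (E D) (F D) {A} {i} Ai
... | true | true | refl = cong (setSystem (E D - i)) (begin
  map (_- i) (map (A ⊕_) (F D))  ≡⟨ map-∘ (F D) ⟨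
  map ((_- i) ∘ (A ⊕_)) (F D)    ≡⟨ map-cong (λ X → minus-twist A X Ai) (F D) ⟩
  map ((A ⊕_) ∘ (_- i)) (F D)    ≡⟨ map-∘ (F D) ⟩
  map (A ⊕_) (map (_- i) (F D))  ∎)
  where open ≡-Reasoning
... | false | false | refl = cong (setSystem (E D - i)) (avoiding-twist (F D) Ai)

-- Deleting a set of elements

deleteIfIn : ∀ {n} → Subset n → SetSystem n → Fin n → SetSystem n
deleteIfIn X D i = if lookup X i then delete D i else D

module _ {n} (X : Subset n) (P : SetSystem n → Set)
         (P-delete : ∀ {D} i → lookup X i ≡ true → P D → P (delete D i)) where

  foldl-deleteIfIn-preserves : ∀ is {D} → P D → P (foldl (deleteIfIn X) D is)
  foldl-deleteIfIn-preserves [] PD = PD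
  foldl-deleteIfIn-preserves (i ∷ is) {D} PD = foldl-deleteIfIn-preserves is P-step
    where
    P-step : P (deleteIfIn X D i)
    P-step with lookup X i in Xi
    ... | true = P-delete i Xi PD
    ... | false = PD

  deleteSet-preserves : ∀ {D} → P D → P (deleteSet D X)
  deleteSet-preserves = foldl-deleteIfIn-preserves (allFin n)

foldl-deleteIfIn-removes : ∀ {n} (X : Subset n) {j} → lookup X j ≡ true →
  ∀ is {D} → j ∈ₗ is → lookup (E (foldl (deleteIfIn X) D is)) j ≡ false
foldl-deleteIfIn-removes X {j} Xj (j ∷ is) {D} (here refl) =
  foldl-deleteIfIn-preserves X (λ D′ → lookup (E D′) j ≡ false) (λ {D′} _ _ → lookup-minus-false (E D′))
    is removed
  where
  removed : lookup (E (deleteIfIn X D j)) j ≡ false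
  removed rewrite Xj = lookup-minus-self (E D) j
foldl-deleteIfIn-removes X Xj (_ ∷ is) (there j∈is) = foldl-deleteIfIn-removes X Xj is j∈is

ground-deleteSet : ∀ {n} (D : SetSystem n) X → E (deleteSet D X) ≡ E D ─ X
ground-deleteSet {n} D X = Subset-ext pointwise
  where
  pointwise : ∀ j → lookup (E (deleteSet D X)) j ≡ lookup (E D ─ X) j
  pointwise j rewrite lookup-─ (E D) X j with lookup X j in Xj
  ... | true = foldl-deleteIfIn-removes X Xj (allFin n) (∈-allFin j)
  ... | false = deleteSet-preserves X (λ D′ → lookup (E D′) j ≡ lookup (E D) j) (λ {D′} → kept {D′}) {D} refl
    where
    kept : ∀ {D′} i → lookup X i ≡ true →
      lookup (E D′) j ≡ lookup (E D) j → lookup (E D′ - i) j ≡ lookup (E D) j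
    kept {D′} i Xi eq = trans (lookup-minus-other (E D′) (∈∧lookup-false⇒≢ Xj (lookup⇒[]= i X Xi) ∘ sym)) eq

ground-restrict : ∀ {n} (D : SetSystem n) {e} → e ∈ E D → E (restrict D e) ≡ ⁅ e ⁆
ground-restrict D {e} e∈E = trans (ground-deleteSet D (E D - e)) (Subset-ext pointwise)
  where
  pointwise : ∀ j → lookup (E D ─ (E D - e)) j ≡ lookup ⁅ e ⁆ j
  pointwise j rewrite lookup-─ (E D) (E D - e) j with j ≟ e
  ... | yes refl rewrite lookup-minus-self (E D) j | lookup-⁅x⁆-self j = []=⇒lookup e∈E
  ... | no j≢e rewrite lookup-minus-other (E D) j≢e | lookup-⁅x⁆-other j≢e with lookup (E D) j
  ...   | true = refl
  ...   | false = refl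

module _ {n} (X A : Subset n) (disjoint : ∀ i → lookup X i ≡ true → lookup A i ≡ false) where

  foldl-deleteIfIn-twist : ∀ is D → foldl (deleteIfIn X) (twist D A) is ≡ twist (foldl (deleteIfIn X) D is) A
  foldl-deleteIfIn-twist [] D = refl
  foldl-deleteIfIn-twist (i ∷ is) D =
    trans (cong (λ D′ → foldl (deleteIfIn X) D′ is) step) (foldl-deleteIfIn-twist is _)
    where
    step : deleteIfIn X (twist D A) i ≡ twist (deleteIfIn X D i) A
    step with lookup X i in Xi
    ... | true = delete-twist D (disjoint i Xi)
    ... | false = refl

  deleteSet-twist : ∀ D → deleteSet (twist D A) X ≡ twist (deleteSet D X) A
  deleteSet-twist = foldl-deleteIfIn-twist (allFin n)

restrict-twist : ∀ {n} (D : SetSystem n) e → restrict (twist D ⁅ e ⁆) e ≡ twist (restrict D e) ⁅ e ⁆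
restrict-twist D e = deleteSet-twist (E D - e) ⁅ e ⁆ disjoint D
  where
  disjoint : ∀ i → lookup (E D - e) i ≡ true → lookup ⁅ e ⁆ i ≡ false
  disjoint i E-e∋i =
    lookup-⁅x⁆-other (∈∧lookup-false⇒≢ (lookup-minus-self (E D) e) (lookup⇒[]= i (E D - e) E-e∋i))

IsDeltaMatroid-deleteSet : ∀ {n} {D : SetSystem n} {X} → IsDeltaMatroid D → IsDeltaMatroid (deleteSet D X)
IsDeltaMatroid-deleteSet {X = X} = deleteSet-preserves X IsDeltaMatroid (λ _ _ → IsDeltaMatroid-delete)

ribbonLoop-deleteSet : ∀ {n} {D : SetSystem n} {X e} → IsDeltaMatroid D → lookup X e ≡ false →
  RibbonLoop (deleteSet D X) e ⇔ RibbonLoop D e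
ribbonLoop-deleteSet {D = D} {X} {e} isDM Xe = proj₂ (deleteSet-preserves X P P-delete (isDM , ⇔-refl))
  where
  P : SetSystem _ → Set
  P D′ = IsDeltaMatroid D′ × (RibbonLoop D′ e ⇔ RibbonLoop D e)
  P-delete : ∀ {D′} i → lookup X i ≡ true → P D′ → P (delete D′ i)
  P-delete i Xi (isDM′ , loop⇔) =
    IsDeltaMatroid-delete isDM′ ,
    ⇔-trans (ribbonLoop-delete isDM′ (∈∧lookup-false⇒≢ Xe (lookup⇒[]= i X Xi))) loop⇔

-- One-element delta-matroids

∅-feasible⇒ribbonLoop : ∀ {n} {D : SetSystem n} {e} → ∅ ∈ₗ F D → RibbonLoop D e
∅-feasible⇒ribbonLoop {n} {e = e} ∅∈ X (_ , X-minimal) e∈X with ∣flip-in∣ X e ([]=⇒lookup e∈X)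
... | ∣X∣≡1+ = case subst₂ _≤_ ∣X∣≡1+ (∣⊥∣≡0 n) (X-minimal ∅ ∅∈) of λ ()

ribbonLoop⇔∅-feasible : ∀ {n} {D : SetSystem n} {e} → IsDeltaMatroid D → E D ≡ ⁅ e ⁆ →
  RibbonLoop D e ⇔ ∅ ∈ₗ F D
ribbonLoop⇔∅-feasible {D = D} {e} isDM E≡⁅e⁆ = mk⇔ to (∅-feasible⇒ribbonLoop {D = D})
  where
  open IsDeltaMatroid isDM
  to : RibbonLoop D e → ∅ ∈ₗ F D
  to loop with minFeasible-exists D nonempty
  ... | M , M-min@(M∈ , _) with ⊆⁅x⁆ (subst (M ⊆_) E≡⁅e⁆ (feasible⊆E M M∈))
  ...   | inj₁ refl = M∈
  ...   | inj₂ refl = ⊥-elim (loop M M-min (x∈⁅x⁆ e))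

∅∈twist⇔ : ∀ {n} {D : SetSystem n} {A} → ∅ ∈ₗ F (twist D A) ⇔ A ∈ₗ F D
∅∈twist⇔ {D = D} {A} = mk⇔ to from
  where
  to : ∅ ∈ₗ map (A ⊕_) (F D) → A ∈ₗ F D
  to ∅∈ with ∈-map⁻ (A ⊕_) ∅∈
  ... | X , X∈ , ∅≡A⊕X = subst (_∈ₗ F D) X≡A X∈
    where
    X≡A : X ≡ A
    X≡A = trans (sym (⊕-involutive A X)) (trans (cong (A ⊕_) (sym ∅≡A⊕X)) (⊕-identityʳ A))
  from : A ∈ₗ F D → ∅ ∈ₗ map (A ⊕_) (F D)
  from A∈ = subst (_∈ₗ map (A ⊕_) (F D)) (⊕-self A) (∈-map⁺ (A ⊕_) A∈)

image-∅ : ∀ {n} (π : Fin n ↔ Fin n) → image π ∅ ≡ ∅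
image-∅ π = Subset-ext λ j → trans (lookup∘tabulate _ j)
  (trans (lookup-replicate (Inverse.from π j) false) (sym (lookup-replicate j false)))

image-id : ∀ {n} (X : Subset n) → image ↔-refl X ≡ X
image-id X = Subset-ext (lookup∘tabulate _)

module OneElement {n} {R : SetSystem n} {e : Fin n} (isDM : IsDeltaMatroid R) (E≡⁅e⁆ : E R ≡ ⁅ e ⁆) where

  open IsDeltaMatroid isDM

  private
    InSingleton : List (Subset n) → Set
    InSingleton L = ∀ X → X ∈ₗ L → X ⊆ ⁅ e ⁆

    R-inSingleton : InSingleton (F R)
    R-inSingleton X X∈ = subst (X ⊆_) E≡⁅e⁆ (feasible⊆E X X∈)

    transfer : ∀ {S T} → InSingleton S → (∅ ∈ₗ S → ∅ ∈ₗ T) → (⁅ e ⁆ ∈ₗ S → ⁅ e ⁆ ∈ₗ T) → ∀ X → X ∈ₗ S → X ∈ₗ T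
    transfer S⊆ ∅→ ⁅e⁆→ X X∈ with ⊆⁅x⁆ (S⊆ X X∈)
    ... | inj₁ refl = ∅→ X∈
    ... | inj₂ refl = ⁅e⁆→ X∈

  ∅-or-⁅e⁆-feasible : ∅ ∈ₗ F R ⊎ ⁅ e ⁆ ∈ₗ F R
  ∅-or-⁅e⁆-feasible with nonempty
  ... | X , X∈ with ⊆⁅x⁆ (R-inSingleton X X∈)
  ...   | inj₁ refl = inj₁ X∈
  ...   | inj₂ refl = inj₂ X∈

  -- Any isomorphism fixes ∅ and the ground set ⁅ e ⁆, the only candidate feasible sets.
  ≅⇔same-feasible : ∀ {L} → InSingleton L →
    R ≅ setSystem ⁅ e ⁆ L ⇔ ((∅ ∈ₗ F R ⇔ ∅ ∈ₗ L) × (⁅ e ⁆ ∈ₗ F R ⇔ ⁅ e ⁆ ∈ₗ L))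
  ≅⇔same-feasible {L} L-inSingleton = mk⇔ to from
    where
    to : R ≅ setSystem ⁅ e ⁆ L → (∅ ∈ₗ F R ⇔ ∅ ∈ₗ L) × (⁅ e ⁆ ∈ₗ F R ⇔ ⁅ e ⁆ ∈ₗ L)
    to (π , image-E , image-F) = fixed (image-∅ π) , fixed (trans (cong (image π) (sym E≡⁅e⁆)) image-E)
      where
      fixed : ∀ {X} → image π X ≡ X → X ∈ₗ F R ⇔ X ∈ₗ L
      fixed {X} π-fixes-X = subst (λ Y → X ∈ₗ F R ⇔ Y ∈ₗ L) π-fixes-X (image-F X)
    from : (∅ ∈ₗ F R ⇔ ∅ ∈ₗ L) × (⁅ e ⁆ ∈ₗ F R ⇔ ⁅ e ⁆ ∈ₗ L) → R ≅ setSystem ⁅ e ⁆ L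
    from (∅⇔ , ⁅e⁆⇔) = ↔-refl , trans (image-id (E R)) E≡⁅e⁆ , λ X →
      subst (λ Y → X ∈ₗ F R ⇔ Y ∈ₗ L) (sym (image-id X))
        (mk⇔ (transfer R-inSingleton (Equivalence.to ∅⇔) (Equivalence.to ⁅e⁆⇔) X)
             (transfer L-inSingleton (Equivalence.from ∅⇔) (Equivalence.from ⁅e⁆⇔) X))

  private
    ∅∉[⁅e⁆] : ¬ ∅ ∈ₗ ⁅ e ⁆ ∷ []
    ∅∉[⁅e⁆] (here ∅≡⁅e⁆) = ∅≢⁅x⁆ ∅≡⁅e⁆

    ⁅e⁆∉[∅] : ¬ ⁅ e ⁆ ∈ₗ ∅ ∷ []
    ⁅e⁆∉[∅] (here ⁅e⁆≡∅) = ∅≢⁅x⁆ (sym ⁅e⁆≡∅)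

    Dc-inSingleton : InSingleton (⁅ e ⁆ ∷ [])
    Dc-inSingleton X (here refl) = λ x∈ → x∈

    Do-inSingleton : InSingleton (∅ ∷ [])
    Do-inSingleton X (here refl) = ⊥⊆

    Dn-inSingleton : InSingleton (∅ ∷ ⁅ e ⁆ ∷ [])
    Dn-inSingleton X (here refl) = ⊥⊆
    Dn-inSingleton X (there (here refl)) = λ x∈ → x∈

  ≅Dc⇔ : R ≅ Dc e ⇔ (¬ ∅ ∈ₗ F R)
  ≅Dc⇔ = mk⇔ to from
    where
    to : R ≅ Dc e → ¬ ∅ ∈ₗ F R
    to iso = ∅∉[⁅e⁆] ∘ Equivalence.to (proj₁ (Equivalence.to (≅⇔same-feasible Dc-inSingleton) iso))
    from : ¬ ∅ ∈ₗ F R → R ≅ Dc e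
    from ∅∉ = Equivalence.from (≅⇔same-feasible Dc-inSingleton)
      (mk⇔ (⊥-elim ∘ ∅∉) (⊥-elim ∘ ∅∉[⁅e⁆]) , mk⇔ (λ _ → here refl) (λ _ → ⁅e⁆∈))
      where
      ⁅e⁆∈ : ⁅ e ⁆ ∈ₗ F R
      ⁅e⁆∈ with ∅-or-⁅e⁆-feasible
      ... | inj₁ ∅∈ = ⊥-elim (∅∉ ∅∈)
      ... | inj₂ ⁅e⁆∈ = ⁅e⁆∈

  ≅Do⇔ : R ≅ Do e ⇔ (∅ ∈ₗ F R × ¬ ⁅ e ⁆ ∈ₗ F R)
  ≅Do⇔ = mk⇔ to from
    where
    to : R ≅ Do e → ∅ ∈ₗ F R × ¬ ⁅ e ⁆ ∈ₗ F R
    to iso with Equivalence.to (≅⇔same-feasible Do-inSingleton) iso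
    ... | ∅⇔ , ⁅e⁆⇔ = Equivalence.from ∅⇔ (here refl) , ⁅e⁆∉[∅] ∘ Equivalence.to ⁅e⁆⇔
    from : ∅ ∈ₗ F R × ¬ ⁅ e ⁆ ∈ₗ F R → R ≅ Do e
    from (∅∈ , ⁅e⁆∉) = Equivalence.from (≅⇔same-feasible Do-inSingleton)
      (mk⇔ (λ _ → here refl) (λ _ → ∅∈) , mk⇔ (⊥-elim ∘ ⁅e⁆∉) (⊥-elim ∘ ⁅e⁆∉[∅]))

  ≅Dn⇔ : R ≅ Dn e ⇔ (∅ ∈ₗ F R × ⁅ e ⁆ ∈ₗ F R)
  ≅Dn⇔ = mk⇔ to from
    where
    to : R ≅ Dn e → ∅ ∈ₗ F R × ⁅ e ⁆ ∈ₗ F R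
    to iso with Equivalence.to (≅⇔same-feasible Dn-inSingleton) iso
    ... | ∅⇔ , ⁅e⁆⇔ = Equivalence.from ∅⇔ (here refl) , Equivalence.from ⁅e⁆⇔ (there (here refl))
    from : ∅ ∈ₗ F R × ⁅ e ⁆ ∈ₗ F R → R ≅ Dn e
    from (∅∈ , ⁅e⁆∈) = Equivalence.from (≅⇔same-feasible Dn-inSingleton)
      (mk⇔ (λ _ → here refl) (λ _ → ∅∈) , mk⇔ (λ _ → there (here refl)) (λ _ → ⁅e⁆∈))

module _ {n} {D : SetSystem n} {e : Fin n} (isDM : IsDeltaMatroid D) (e∈E : e ∈ E D) where

  private
    e∉E-e : lookup (E D - e) e ≡ false
    e∉E-e = lookup-minus-self (E D) e

    ⁅e⁆⊆ : ∀ {S} → e ∈ S → ⁅ e ⁆ ⊆ S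
    ⁅e⁆⊆ {S} e∈S x∈⁅e⁆ = subst (_∈ S) (sym (x∈⁅y⁆⇒x≡y e x∈⁅e⁆)) e∈S

  IsDeltaMatroid-restrict : IsDeltaMatroid (restrict D e)
  IsDeltaMatroid-restrict = IsDeltaMatroid-deleteSet {X = E D - e} isDM

  ribbonLoop⇔∅∈restrict : RibbonLoop D e ⇔ ∅ ∈ₗ F (restrict D e)
  ribbonLoop⇔∅∈restrict = ⇔-trans (⇔-sym (ribbonLoop-deleteSet {X = E D - e} isDM e∉E-e))
    (ribbonLoop⇔∅-feasible IsDeltaMatroid-restrict (ground-restrict D e∈E))

  twistedRibbonLoop⇔⁅e⁆∈restrict : RibbonLoop (twist D ⁅ e ⁆) e ⇔ ⁅ e ⁆ ∈ₗ F (restrict D e)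
  twistedRibbonLoop⇔⁅e⁆∈restrict =
    ⇔-trans (⇔-sym (ribbonLoop-deleteSet {X = E D - e} isDM* e∉E-e))
      (subst (λ T → RibbonLoop T e ⇔ ⁅ e ⁆ ∈ₗ F (restrict D e)) (sym (restrict-twist D e))
        (⇔-trans (ribbonLoop⇔∅-feasible isDM-restrict* (ground-restrict D e∈E)) (∅∈twist⇔ {D = restrict D e})))
    where
    isDM* : IsDeltaMatroid (twist D ⁅ e ⁆)
    isDM* = IsDeltaMatroid-twist (⁅e⁆⊆ e∈E) isDM
    isDM-restrict* : IsDeltaMatroid (twist (restrict D e) ⁅ e ⁆)
    isDM-restrict* =
      IsDeltaMatroid-twist (⁅e⁆⊆ (subst (e ∈_) (sym (ground-restrict D e∈E)) (x∈⁅x⁆ e))) IsDeltaMatroid-restrict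

lemma3p26 : ∀ {n} (D : SetSystem n) → IsDeltaMatroid D → (e : Fin n) → e ∈ E D →
    ((¬ RibbonLoop D e) ⇔ (restrict D e ≅ Dc e))
    × (OrientableRibbonLoop D e ⇔ (restrict D e ≅ Do e))
    × (NonOrientableRibbonLoop D e ⇔ (restrict D e ≅ Dn e))
lemma3p26 D isDM e e∈E =
    ⇔-trans (¬-cong-⇔ loop⇔∅) (⇔-sym ≅Dc⇔)
  , ⇔-trans (loop⇔∅ ×-⇔ ¬-cong-⇔ twistedLoop⇔⁅e⁆) (⇔-sym ≅Do⇔)
  , ⇔-trans (loop⇔∅ ×-⇔ twistedLoop⇔⁅e⁆) (⇔-sym ≅Dn⇔)
  where
  open OneElement (IsDeltaMatroid-restrict isDM e∈E) (ground-restrict D e∈E)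
  loop⇔∅ : RibbonLoop D e ⇔ ∅ ∈ₗ F (restrict D e)
  loop⇔∅ = ribbonLoop⇔∅∈restrict isDM e∈E
  twistedLoop⇔⁅e⁆ : RibbonLoop (twist D ⁅ e ⁆) e ⇔ ⁅ e ⁆ ∈ₗ F (restrict D e)
  twistedLoop⇔⁅e⁆ = twistedRibbonLoop⇔⁅e⁆∈restrict isDM e∈E
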